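{- Let $(P,+,\cdot,0,1)$ be a finite dual of a Boolean poset. Define $x\le y$ if $x\cdot y=x$, and $x':=x+1$, for $x,y\in P$. Then $(P,\le,{}',0,1)$ is a Boolean poset.
   Context: A dual of a Boolean poset is a structure $(P,+,\cdot,0,1)$ where $+,\cdot$ are binary operators on $P$ (defined on pairs of elements and of subsets, with values subsets of $P$; elements identified with singletons), $0,1\in P$, such that for all $x,y,z\in P$ and $A,B\subseteq P$: (i) $x\cdot x=x$, $x\cdot y=y\cdot x$, $x\cdot0=0$, $x\cdot1=x$, $(x\cdot(y\cdot z))\cdot z=(x\cdot(y\cdot z))\cdot1$; (ii) $(x+1)+1=x$; (iii) $x\cdot y=x$ implies $(x+1)\cdot(y+1)=y+1$; (iv) $x\cdot(x+1)=0$; (v) $\Big(\big((x+1)\cdot(y+1)\big)+1\Big)\cdot z=\Big(\big(((x\cdot z)+1)\cdot((y\cdot z)+1)\big)+1\Big)\cdot1$; (vi) $x\in A\cdot B$ if and only if [$x\cdot y=x$ for all $y\in A\cup B$, and every $z\in P$ with $x\cdot z=x$ and $z\cdot y=z$ for all $y\in A\cup B$ satisfies $z=x$]. For a poset and $X\subseteq P$, $L(X)$, $U(X)$ are the sets of lower/upper bounds; $L(x,y)=L(\{x,y\})$, $LU(X)=L(U(X))$. A complemented poset is a bounded poset $(P,\le,{}',0,1)$ with an antitone involution $'$ such that $L(x,x')=\{0\}$, $U(x,x')=\{1\}$ for all $x$. A poset is distributive if $L(U(x,y),z)=LU(L(x,z),L(y,z))$ for all $x,y,z$. A Boolean poset is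 a distributive complemented poset. -}

module Defs where

open import Level using (0ℓ)
open import Data.Nat using (ℕ)
open import Data.Fin using (Fin)
open import Data.Product using (Σ; ∃; _×_; _,_)
open import Relation.Binary.PropositionalEquality using (_≡_)
open import Relation.Unary using (Pred; ｛_｝; _≐_; _∪_; _∈_)
open import Function.Bundles using (_↔_)

Finite : Set → Set
Finite P = Σ ℕ λ n → P ↔ Fin n

Subset : Set → Set₁
Subset P = Pred P 0ℓ

module PosetNotions {P : Set} (_≤_ : P → P → Set) where

  L : Subset P → Subset P
  L X z = ∀ y → y ∈ X → z ≤ y

  U : Subset P → Subset P
  U X z = ∀ y → y ∈ X → y ≤ z

  pair : P → P → Subset P
  pair x y = ｛ x ｝ ∪ ｛ y ｝

  L₂ : P → P → Subset P
  L₂ x y = L (pair x y)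

  U₂ : P → P → Subset P
  U₂ x y = U (pair x y)

  LU : Subset P → Subset P
  LU X = L (U X)

  record IsPartialOrder : Set where
    field
      refl    : ∀ x → x ≤ x
      antisym : ∀ x y → x ≤ y → y ≤ x → x ≡ y
      trans   : ∀ x y z → x ≤ y → y ≤ z → x ≤ z

  record IsComplementedPoset (c : P → P) (𝟎 𝟏 : P) : Set where
    field
      partialOrder : IsPartialOrder
      least        : ∀ x → 𝟎 ≤ x
      greatest     : ∀ x → x ≤ 𝟏
      antitone     : ∀ x y → x ≤ y → c y ≤ c x
      involutive   : ∀ x → c (c x) ≡ x
      L-compl      : ∀ x → L₂ x (c x) ≐ ｛ 𝟎 ｝
      U-compl      : ∀ x → U₂ x (c x) ≐ ｛ 𝟏 ｝

  IsDistributive : Set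
  IsDistributive = ∀ x y z →
    L (U₂ x y ∪ ｛ z ｝) ≐ LU (L₂ x z ∪ L₂ y z)

  record IsBooleanPoset (c : P → P) (𝟎 𝟏 : P) : Set where
    field
      complemented : IsComplementedPoset c 𝟎 𝟏
      distributive : IsDistributive

-- Dual of a Boolean poset.
-- · is given on subsets (elements identified with singletons);
-- + is given on pairs of elements and extended to subsets elementwise:
--   A ⊕ B = ⋃ { a + b | a ∈ A , b ∈ B }.

record DualBooleanPoset (P : Set) : Set₁ where
  infixl 7 _·_
  infixl 6 _+_ _⊕_
  field
    _·_ : Subset P → Subset P → Subset P
    _+_ : P → P → Subset P
    𝟎 𝟏 : P

  _⊕_ : Subset P → Subset P → Subset P
  (A ⊕ B) w = ∃ λ a → ∃ λ b → a ∈ A × b ∈ B × w ∈ (a + b)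

  ⟦_⟧ : P → Subset P
  ⟦ x ⟧ = ｛ x ｝

  field
    idem   : ∀ x → ⟦ x ⟧ · ⟦ x ⟧ ≐ ⟦ x ⟧
    comm   : ∀ x y → ⟦ x ⟧ · ⟦ y ⟧ ≐ ⟦ y ⟧ · ⟦ x ⟧
    zero-r : ∀ x → ⟦ x ⟧ · ⟦ 𝟎 ⟧ ≐ ⟦ 𝟎 ⟧
    one-r  : ∀ x → ⟦ x ⟧ · ⟦ 𝟏 ⟧ ≐ ⟦ x ⟧
    ax-i5  : ∀ x y z →
      (⟦ x ⟧ · (⟦ y ⟧ · ⟦ z ⟧)) · ⟦ z ⟧ ≐ (⟦ x ⟧ · (⟦ y ⟧ · ⟦ z ⟧)) · ⟦ 𝟏 ⟧
    ax-ii  : ∀ x → (⟦ x ⟧ ⊕ ⟦ 𝟏 ⟧) ⊕ ⟦ 𝟏 ⟧ ≐ ⟦ x ⟧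
    ax-iii : ∀ x y → ⟦ x ⟧ · ⟦ y ⟧ ≐ ⟦ x ⟧ →
      (⟦ x ⟧ ⊕ ⟦ 𝟏 ⟧) · (⟦ y ⟧ ⊕ ⟦ 𝟏 ⟧) ≐ ⟦ y ⟧ ⊕ ⟦ 𝟏 ⟧
    ax-iv  : ∀ x → ⟦ x ⟧ · (⟦ x ⟧ ⊕ ⟦ 𝟏 ⟧) ≐ ⟦ 𝟎 ⟧
    ax-v   : ∀ x y z →
      (((⟦ x ⟧ ⊕ ⟦ 𝟏 ⟧) · (⟦ y ⟧ ⊕ ⟦ 𝟏 ⟧)) ⊕ ⟦ 𝟏 ⟧) · ⟦ z ⟧
        ≐ ((((⟦ x ⟧ · ⟦ z ⟧) ⊕ ⟦ 𝟏 ⟧) · ((⟦ y ⟧ · ⟦ z ⟧) ⊕ ⟦ 𝟏 ⟧)) ⊕ ⟦ 𝟏 ⟧) · ⟦ 𝟏 ⟧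
    ax-vi-⇒ : ∀ (A B : Subset P) x → x ∈ A · B →
      (∀ y → y ∈ (A ∪ B) → ⟦ x ⟧ · ⟦ y ⟧ ≐ ⟦ x ⟧) ×
      (∀ z → ⟦ x ⟧ · ⟦ z ⟧ ≐ ⟦ x ⟧ →
             (∀ y → y ∈ (A ∪ B) → ⟦ z ⟧ · ⟦ y ⟧ ≐ ⟦ z ⟧) → z ≡ x)
    ax-vi-⇐ : ∀ (A B : Subset P) x →
      (∀ y → y ∈ (A ∪ B) → ⟦ x ⟧ · ⟦ y ⟧ ≐ ⟦ x ⟧) →
      (∀ z → ⟦ x ⟧ · ⟦ z ⟧ ≐ ⟦ x ⟧ →
             (∀ y → y ∈ (A ∪ B) → ⟦ z ⟧ · ⟦ y ⟧ ≐ ⟦ z ⟧) → z ≡ x) →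
      x ∈ A · B

  _≤_ : P → P → Set
  x ≤ y = ⟦ x ⟧ · ⟦ y ⟧ ≐ ⟦ x ⟧

-- The order laws and the complementation laws come from (i)–(iv) and (vi);
-- (ii) alone makes x + 1 a singleton {x′}.  For distributivity only
-- L(U(x,y),z) ⊆ LU(L(x,z),L(y,z)) needs work: given w on the left and v on the
-- right, axiom (v) at z := w places w below every element of ((x·w)′·(y·w)′)′,
-- and a maximal lower bound s of (x·w)′ ∪ (y·w)′ above v′, which exists since
-- P is finite, yields w ≤ s′ ≤ v.  Constructively that maximal element exists
-- only up to double negation, which suffices because ≤ is ¬¬-stable, again by (v).

module Submission where

open import Defs
open import Level using (0ℓ)
open import Data.Fin.Induction using (spo-noetherian)
open import Data.Fin.Properties using (inj⇒≟)
open import Data.Product using (Σ; ∃; _×_; _,_; proj₁; proj₂)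
open import Data.Sum using (inj₁; inj₂; [_,_]′)
import Data.Sum as Sum
open import Function using (_∘_; flip)
open import Function.Bundles using (Inverse)
open import Function.Properties.Inverse using (↔⇒↣)
open import Induction.WellFounded using (WellFounded; Acc; acc; module Subrelation)
open import Relation.Binary.Core using (Rel)
open import Relation.Binary.Definitions using (DecidableEquality)
open import Relation.Binary.PropositionalEquality using (_≡_; refl; sym; trans; cong; subst; subst₂)
import Relation.Binary.PropositionalEquality as Eq
open import Relation.Binary.Structures using (IsPartialOrder)
open import Relation.Nullary using (¬_)
open import Relation.Nullary.Decidable using (decidable-stable)
open import Relation.Nullary.Negation using (contradiction)
open import Relation.Unary using (｛_｝; _≐_; _∈_; _∪_; _⊆_)
open import Relation.Unary.Properties using (≐-refl; ≐-sym; ≐-trans)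
open import Relation.Unary.Relation.Binary.Equality using (≐-setoid)
import Relation.Binary.Construct.NonStrictToStrict as NonStrictToStrict
import Relation.Binary.Construct.On as On
import Relation.Binary.Reasoning.Setoid as SetoidReasoning

Maximal : {A : Set} → Rel A 0ℓ → Subset A → Subset A
Maximal _≤_ S m = m ∈ S × (∀ z → m ≤ z → z ∈ S → z ≡ m)

finite⇒≟ : {A : Set} → Finite A → DecidableEquality A
finite⇒≟ (_ , A↔Fin) = inj⇒≟ (↔⇒↣ A↔Fin)

module FinitePoset {A : Set} {_≤_ : Rel A 0ℓ}
                   (≤-isPartialOrder : IsPartialOrder _≡_ _≤_) (finite : Finite A) where

  open IsPartialOrder ≤-isPartialOrder using () renaming (refl to ≤-refl; trans to ≤-trans)
  open NonStrictToStrict _≡_ _≤_ using (_<_; <-isStrictPartialOrder)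
  open Inverse (proj₂ finite) using (to; from; strictlyInverseʳ)

  <-noetherian : WellFounded (flip _<_)
  <-noetherian = Subrelation.wellFounded through-Fin
    (On.wellFounded to (spo-noetherian (On.isStrictPartialOrder from
                                          (<-isStrictPartialOrder ≤-isPartialOrder))))
    where
    through-Fin : ∀ {x y} → y < x → from (to y) < from (to x)
    through-Fin {x} {y} = subst₂ _<_ (sym (strictlyInverseʳ y)) (sym (strictlyInverseʳ x))

  ¬¬-maximal-above : (S : Subset A) → ∀ {t} → t ∈ S →
                     ¬ ¬ (∃ λ m → t ≤ m × Maximal _≤_ S m)
  ¬¬-maximal-above S = go (<-noetherian _)
    where
    go : ∀ {t} → Acc (flip _<_) t → t ∈ S → ¬ ¬ (∃ λ m → t ≤ m × Maximal _≤_ S m)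
    go {t} (acc above) t∈S none = none (t , ≤-refl , t∈S , t-maximal)
      where
      t-maximal : ∀ z → t ≤ z → z ∈ S → z ≡ t
      t-maximal z t≤z z∈S = decidable-stable (finite⇒≟ finite z t) λ z≢t →
        go (above (t≤z , z≢t ∘ sym)) z∈S
          λ (m , z≤m , m-maximal) → none (m , ≤-trans t≤z z≤m , m-maximal)

module DualBooleanPosetProperties {P : Set} (D : DualBooleanPoset P) where

  open DualBooleanPoset D
  open PosetNotions _≤_ using (L; LU; L₂; U₂; IsDistributive; IsBooleanPoset)
  open SetoidReasoning (≐-setoid P 0ℓ)

  ∈·⇒maximal : ∀ {A B x} → x ∈ A · B → Maximal _≤_ (L (A ∪ B)) x
  ∈·⇒maximal = ax-vi-⇒ _ _ _

  maximal⇒∈· : ∀ {A B x} → Maximal _≤_ (L (A ∪ B)) x → x ∈ A · B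
  maximal⇒∈· (x-lb , x-max) = ax-vi-⇐ _ _ _ x-lb x-max

  ∈⟦⟧·⟦⟧⇒≤ˡ : ∀ {a b m} → m ∈ ⟦ a ⟧ · ⟦ b ⟧ → m ≤ a
  ∈⟦⟧·⟦⟧⇒≤ˡ m∈ = proj₁ (∈·⇒maximal m∈) _ (inj₁ refl)

  ∈⟦⟧·⟦⟧⇒≤ʳ : ∀ {a b m} → m ∈ ⟦ a ⟧ · ⟦ b ⟧ → m ≤ b
  ∈⟦⟧·⟦⟧⇒≤ʳ m∈ = proj₁ (∈·⇒maximal m∈) _ (inj₂ refl)

  ·-⊆ : ∀ {A A′ B B′} → A ≐ A′ → B ≐ B′ → A · B ⊆ A′ · B′
  ·-⊆ (A⊆A′ , A′⊆A) (B⊆B′ , B′⊆B) x∈ with ∈·⇒maximal x∈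
  ... | x-lb , x-max =
    maximal⇒∈· (L-antitone (Sum.map A′⊆A B′⊆B) x-lb ,
                λ z x≤z z-lb → x-max z x≤z (L-antitone (Sum.map A⊆A′ B⊆B′) z-lb))
    where
    L-antitone : ∀ {X Y} → Y ⊆ X → L X ⊆ L Y
    L-antitone Y⊆X x-lb y y∈Y = x-lb y (Y⊆X y∈Y)

  ·-cong : ∀ {A A′ B B′} → A ≐ A′ → B ≐ B′ → A · B ≐ A′ · B′
  ·-cong A≐A′ B≐B′ = ·-⊆ A≐A′ B≐B′ , ·-⊆ (≐-sym A≐A′) (≐-sym B≐B′)

  ≤-refl : ∀ {x} → x ≤ x
  ≤-refl = idem _

  ≤-antisym : ∀ {x y} → x ≤ y → y ≤ x → x ≡ y
  ≤-antisym {x} {y} x≤y y≤x = sym (proj₁ y≤x (proj₁ (comm x y) (proj₂ x≤y refl)))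

  ≤-trans : ∀ {x y z} → x ≤ y → y ≤ z → x ≤ z
  ≤-trans {x} {y} {z} x≤y y≤z = begin
    ⟦ x ⟧ · ⟦ z ⟧                      ≈⟨ ·-cong x≐x·[y·z] ≐-refl ⟩
    (⟦ x ⟧ · (⟦ y ⟧ · ⟦ z ⟧)) · ⟦ z ⟧  ≈⟨ ax-i5 x y z ⟩
    (⟦ x ⟧ · (⟦ y ⟧ · ⟦ z ⟧)) · ⟦ 𝟏 ⟧  ≈⟨ ·-cong x≐x·[y·z] ≐-refl ⟨
    ⟦ x ⟧ · ⟦ 𝟏 ⟧                      ≈⟨ one-r x ⟩
    ⟦ x ⟧                              ∎
    where
    x≐x·[y·z] : ⟦ x ⟧ ≐ ⟦ x ⟧ · (⟦ y ⟧ · ⟦ z ⟧)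
    x≐x·[y·z] = ≐-sym (≐-trans (·-cong ≐-refl y≤z) x≤y)

  ≤-least : ∀ {x} → 𝟎 ≤ x
  ≤-least {x} = ≐-trans (comm 𝟎 x) (zero-r x)

  ≤-greatest : ∀ {x} → x ≤ 𝟏
  ≤-greatest = one-r _

  L₂-intro : ∀ {a b w} → w ≤ a → w ≤ b → w ∈ L₂ a b
  L₂-intro w≤a _ _ (inj₁ refl) = w≤a
  L₂-intro _ w≤b _ (inj₂ refl) = w≤b

  U₂-intro : ∀ {a b w} → a ≤ w → b ≤ w → w ∈ U₂ a b
  U₂-intro a≤w _ _ (inj₁ refl) = a≤w
  U₂-intro _ b≤w _ (inj₂ refl) = b≤w

  ≤-isPartialOrder : IsPartialOrder _≡_ _≤_
  ≤-isPartialOrder = record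
    { isPreorder = record
      { isEquivalence = Eq.isEquivalence
      ; reflexive     = λ { refl → ≤-refl }
      ; trans         = ≤-trans
      }
    ; antisym = ≤-antisym
    }

  infix 8 _′
  _′ : Subset P → Subset P
  S ′ = S ⊕ ⟦ 𝟏 ⟧

  ′-cong : ∀ {S T} → S ≐ T → S ′ ≐ T ′
  ′-cong (S⊆T , T⊆S) =
    (λ (a , b , a∈S , b∈𝟏 , w∈a+b) → a , b , S⊆T a∈S , b∈𝟏 , w∈a+b) ,
    (λ (a , b , a∈T , b∈𝟏 , w∈a+b) → a , b , T⊆S a∈T , b∈𝟏 , w∈a+b)

  complement-witness : ∀ x → ∃ λ a → a ∈ ⟦ x ⟧ ′ × x ∈ ⟦ a ⟧ ′
  complement-witness x with proj₂ (ax-ii x) refl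
  ... | a , _ , a∈x′ , refl , x∈a+𝟏 = a , a∈x′ , (a , 𝟏 , refl , refl , x∈a+𝟏)

  compl : P → P
  compl x = proj₁ (complement-witness x)

  -- (ii) alone forces x + 1 to be a singleton: any d ∈ (compl x) + 1 lies in (x′)′ = {x}.
  ⟦compl⟧′≐⟦⟧ : ∀ x → ⟦ compl x ⟧ ′ ≐ ⟦ x ⟧
  ⟦compl⟧′≐⟦⟧ x with complement-witness x
  ... | a , a∈x′ , x∈a′ =
    (λ { (_ , _ , refl , refl , d∈a+𝟏) → proj₁ (ax-ii x) (a , 𝟏 , a∈x′ , refl , d∈a+𝟏) }) ,
    (λ { refl → x∈a′ })

  ⟦⟧′≐⟦compl⟧ : ∀ x → ⟦ x ⟧ ′ ≐ ⟦ compl x ⟧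
  ⟦⟧′≐⟦compl⟧ x = ≐-trans (′-cong (≐-sym (⟦compl⟧′≐⟦⟧ x))) (ax-ii (compl x))

  compl-involutive : ∀ x → compl (compl x) ≡ x
  compl-involutive x = sym (proj₁ (⟦compl⟧′≐⟦⟧ x) (proj₂ (⟦⟧′≐⟦compl⟧ (compl x)) refl))

  ∈′-elim : ∀ {S w} → w ∈ S ′ → ∃ λ a → a ∈ S × w ≡ compl a
  ∈′-elim (a , _ , a∈S , refl , w∈a+𝟏) = a , a∈S , sym (proj₁ (⟦⟧′≐⟦compl⟧ a) (a , 𝟏 , refl , refl , w∈a+𝟏))

  ∈′-intro : ∀ {S a} → a ∈ S → compl a ∈ S ′
  ∈′-intro {a = a} a∈S with proj₂ (⟦⟧′≐⟦compl⟧ a) refl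
  ... | _ , _ , refl , refl , ca∈a+𝟏 = a , 𝟏 , a∈S , refl , ca∈a+𝟏

  compl-antitone : ∀ {x y} → x ≤ y → compl y ≤ compl x
  compl-antitone {x} {y} x≤y = begin
    ⟦ compl y ⟧ · ⟦ compl x ⟧  ≈⟨ comm (compl y) (compl x) ⟩
    ⟦ compl x ⟧ · ⟦ compl y ⟧  ≈⟨ ·-cong (⟦⟧′≐⟦compl⟧ x) (⟦⟧′≐⟦compl⟧ y) ⟨
    ⟦ x ⟧ ′ · ⟦ y ⟧ ′          ≈⟨ ax-iii x y x≤y ⟩
    ⟦ y ⟧ ′                    ≈⟨ ⟦⟧′≐⟦compl⟧ y ⟩
    ⟦ compl y ⟧                ∎

  ≤compl⇒≤compl : ∀ {x y} → x ≤ compl y → y ≤ compl x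
  ≤compl⇒≤compl {x} {y} x≤cy = subst (_≤ compl x) (compl-involutive y) (compl-antitone x≤cy)

  compl≤⇒compl≤ : ∀ {x y} → compl x ≤ y → compl y ≤ x
  compl≤⇒compl≤ {x} {y} cx≤y = subst (compl y ≤_) (compl-involutive x) (compl-antitone cx≤y)

  L-compl : ∀ x → L₂ x (compl x) ≐ ｛ 𝟎 ｝
  L-compl x =
    (λ {z} z-lb → sym (proj₂ (∈·⇒maximal 𝟎∈x·x′) z ≤-least z-lb)) ,
    (λ { refl _ _ → ≤-least })
    where
    𝟎∈x·x′ : 𝟎 ∈ ⟦ x ⟧ · ⟦ compl x ⟧
    𝟎∈x·x′ = proj₂ (≐-trans (·-cong ≐-refl (≐-sym (⟦⟧′≐⟦compl⟧ x))) (ax-iv x)) refl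

  compl-𝟎 : compl 𝟎 ≡ 𝟏
  compl-𝟎 = subst (λ a → compl a ≡ 𝟏) compl-𝟏 (compl-involutive 𝟏)
    where
    compl-𝟏 : compl 𝟏 ≡ 𝟎
    compl-𝟏 = sym (proj₁ (L-compl 𝟏) (L₂-intro ≤-greatest ≤-refl))

  U-compl : ∀ x → U₂ x (compl x) ≐ ｛ 𝟏 ｝
  U-compl x =
    (λ {z} z-ub → trans (sym compl-𝟎) (trans (cong compl (𝟎≡cz z-ub)) (compl-involutive z))) ,
    (λ { refl _ _ → ≤-greatest })
    where
    𝟎≡cz : ∀ {z} → z ∈ U₂ x (compl x) → 𝟎 ≡ compl z
    𝟎≡cz z-ub = proj₁ (L-compl x)
      (L₂-intro (compl≤⇒compl≤ (z-ub _ (inj₂ refl))) (compl-antitone (z-ub _ (inj₁ refl))))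

  [x′·x′]′≐x : ∀ x → (⟦ x ⟧ ′ · ⟦ x ⟧ ′) ′ ≐ ⟦ x ⟧
  [x′·x′]′≐x x = begin
    (⟦ x ⟧ ′ · ⟦ x ⟧ ′) ′              ≈⟨ ′-cong (·-cong (⟦⟧′≐⟦compl⟧ x) (⟦⟧′≐⟦compl⟧ x)) ⟩
    (⟦ compl x ⟧ · ⟦ compl x ⟧) ′      ≈⟨ ′-cong (idem (compl x)) ⟩
    ⟦ compl x ⟧ ′                      ≈⟨ ⟦compl⟧′≐⟦⟧ x ⟩
    ⟦ x ⟧                              ∎

  module _ (finite : Finite P) where

    open FinitePoset ≤-isPartialOrder finite using (¬¬-maximal-above)

    -- Equality is decidable, so the maximality half of (vi) is ¬¬-stable.
    ·≐｛least-element｝ : ∀ {A B m} → m ∈ L (A ∪ B) → ¬ ¬ (m ∈ A ∪ B) → A · B ≐ ｛ m ｝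
    ·≐｛least-element｝ {m = m} m-lb ¬¬m∈ =
      (λ {x} x∈ → decidable-stable (finite⇒≟ finite m x) λ m≢x →
         ¬¬m∈ λ m∈ → m≢x (proj₂ (∈·⇒maximal x∈) m (proj₁ (∈·⇒maximal x∈) m m∈) m-lb)) ,
      (λ { refl → maximal⇒∈· (m-lb , λ z m≤z z-lb → decidable-stable (finite⇒≟ finite z m)
                     λ z≢m → ¬¬m∈ λ m∈ → z≢m (≤-antisym (z-lb m m∈) m≤z)) })

    -- (v) with x = y = b and z = a rewrites b · a through complements, and the
    -- rewritten side is the singleton {a} as soon as a ≤ b is not refuted.
    ≤-stable : ∀ {a b} → ¬ ¬ (a ≤ b) → a ≤ b
    ≤-stable {a} {b} ¬¬a≤b = begin
      ⟦ a ⟧ · ⟦ b ⟧                         ≈⟨ comm a b ⟩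
      ⟦ b ⟧ · ⟦ a ⟧                         ≈⟨ ·-cong ([x′·x′]′≐x b) ≐-refl ⟨
      (⟦ b ⟧ ′ · ⟦ b ⟧ ′) ′ · ⟦ a ⟧         ≈⟨ ax-v b b a ⟩
      (T · T) ′ · ⟦ 𝟏 ⟧                     ≈⟨ ·-cong (′-cong T·T≐｛compl-a｝) ≐-refl ⟩
      ⟦ compl a ⟧ ′ · ⟦ 𝟏 ⟧                 ≈⟨ ·-cong (⟦compl⟧′≐⟦⟧ a) ≐-refl ⟩
      ⟦ a ⟧ · ⟦ 𝟏 ⟧                         ≈⟨ one-r a ⟩
      ⟦ a ⟧                                 ∎
      where
      T : Subset P
      T = (⟦ b ⟧ · ⟦ a ⟧) ′

      compl-a-lb : compl a ∈ L T
      compl-a-lb _ t∈T with ∈′-elim t∈T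
      ... | m , m∈b·a , refl = compl-antitone (∈⟦⟧·⟦⟧⇒≤ʳ m∈b·a)

      compl-a∈T : a ≤ b → compl a ∈ T
      compl-a∈T a≤b = ∈′-intro (proj₂ (≐-trans (comm b a) a≤b) refl)

      T·T≐｛compl-a｝ : T · T ≐ ⟦ compl a ⟧
      T·T≐｛compl-a｝ = ·≐｛least-element｝ (λ t → [ compl-a-lb t , compl-a-lb t ]′)
                                           λ ∉ → ¬¬a≤b (∉ ∘ inj₁ ∘ compl-a∈T)

    L-U₂∪⊆LU-L₂∪L₂ : ∀ {x y z} → L (U₂ x y ∪ ｛ z ｝) ⊆ LU (L₂ x z ∪ L₂ y z)
    L-U₂∪⊆LU-L₂∪L₂ {x} {y} {z} {w} w-lb v v-ub = ≤-stable λ w≰v →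
      ¬¬-maximal-above (L (A₁ ∪ B₁)) compl-v-lb λ (s , cv≤s , s-maximal) →
        w≰v (≤-trans (w≤R (∈′-intro (maximal⇒∈· s-maximal))) (compl≤⇒compl≤ cv≤s))
      where
      A₁ B₁ : Subset P
      A₁ = (⟦ x ⟧ · ⟦ w ⟧) ′
      B₁ = (⟦ y ⟧ · ⟦ w ⟧) ′

      w≤z : w ≤ z
      w≤z = w-lb z (inj₂ refl)

      w-lb-X : w ∈ L ((⟦ x ⟧ ′ · ⟦ y ⟧ ′) ′ ∪ ⟦ w ⟧)
      w-lb-X _ (inj₂ refl) = ≤-refl
      w-lb-X _ (inj₁ r∈X) with ∈′-elim r∈X
      ... | s , s∈ , refl = w-lb (compl s) (inj₁ (U₂-intro
        (≤compl⇒≤compl (proj₁ (∈·⇒maximal s∈) _ (inj₁ (∈′-intro refl))))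
        (≤compl⇒≤compl (proj₁ (∈·⇒maximal s∈) _ (inj₂ (∈′-intro refl))))))

      w≤R : ∀ {r} → r ∈ (A₁ · B₁) ′ → w ≤ r
      w≤R r∈R = proj₁ (∈·⇒maximal w∈R·𝟏) _ (inj₁ r∈R)
        where
        w∈R·𝟏 : w ∈ (A₁ · B₁) ′ · ⟦ 𝟏 ⟧
        w∈R·𝟏 = proj₁ (ax-v x y w)
          (proj₂ (·≐｛least-element｝ w-lb-X (contradiction (inj₂ refl))) refl)

      ∈L₂-z : ∀ {u m} → m ∈ ⟦ u ⟧ · ⟦ w ⟧ → m ∈ L₂ u z
      ∈L₂-z m∈ = L₂-intro (∈⟦⟧·⟦⟧⇒≤ˡ m∈) (≤-trans (∈⟦⟧·⟦⟧⇒≤ʳ m∈) w≤z)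

      compl-v-lb : compl v ∈ L (A₁ ∪ B₁)
      compl-v-lb _ (inj₁ t∈A₁) with ∈′-elim t∈A₁
      ... | m , m∈ , refl = compl-antitone (v-ub m (inj₁ (∈L₂-z m∈)))
      compl-v-lb _ (inj₂ t∈B₁) with ∈′-elim t∈B₁
      ... | m , m∈ , refl = compl-antitone (v-ub m (inj₂ (∈L₂-z m∈)))

    distributive : IsDistributive
    distributive x y z = L-U₂∪⊆LU-L₂∪L₂ , LU-L₂∪L₂⊆L-U₂∪
      where
      LU-L₂∪L₂⊆L-U₂∪ : LU (L₂ x z ∪ L₂ y z) ⊆ L (U₂ x y ∪ ｛ z ｝)
      LU-L₂∪L₂⊆L-U₂∪ w-lb _ (inj₂ refl) = w-lb z λ
        { _ (inj₁ r-lb) → r-lb z (inj₂ refl)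
        ; _ (inj₂ r-lb) → r-lb z (inj₂ refl) }
      LU-L₂∪L₂⊆L-U₂∪ w-lb q (inj₁ q-ub) = w-lb q λ
        { _ (inj₁ r-lb) → ≤-trans (r-lb x (inj₁ refl)) (q-ub x (inj₁ refl))
        ; _ (inj₂ r-lb) → ≤-trans (r-lb y (inj₁ refl)) (q-ub y (inj₂ refl)) }

    isBooleanPoset : IsBooleanPoset compl 𝟎 𝟏
    isBooleanPoset = record
      { complemented = record
        { partialOrder = record
          { refl    = λ _ → ≤-refl
          ; antisym = λ _ _ → ≤-antisym
          ; trans   = λ _ _ _ → ≤-trans
          }
        ; least      = λ _ → ≤-least
        ; greatest   = λ _ → ≤-greatest
        ; antitone   = λ _ _ → compl-antitone
        ; involutive = compl-involutive
        ; L-compl    = L-compl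
        ; U-compl    = U-compl
        }
      ; distributive = distributive
      }

theorem5p3 : (P : Set) (D : DualBooleanPoset P) → Finite P →
    let open DualBooleanPoset D in
    Σ (P → P) λ c →
      (∀ x → (｛ x ｝ ⊕ ｛ 𝟏 ｝) ≐ ｛ c x ｝) ×
      PosetNotions.IsBooleanPoset _≤_ c 𝟎 𝟏
theorem5p3 P D finite = compl , ⟦⟧′≐⟦compl⟧ , isBooleanPoset finite
  where open DualBooleanPosetProperties D
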